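{- Let $\mathfrak{F}$ be a Frankenstein graph and let $\mathsf{P} \subseteq \mathfrak{F}$ be a path with terminals $s$ and $t$. Then there exists a rainbow path $\mathsf{P}' \subseteq \mathfrak{F}$ with the same terminals $s$ and $t$.
   Context: A (colored) graph is a finite set $\mathsf{G}$ of pairs $(e,\alpha)$ where $e=\{u,v\}$ is a set of two distinct vertices and $\alpha$ is a color, such that no two pairs in $\mathsf{G}$ have the same $e$ (colors may repeat). $V(\mathsf{G})$ is the set of vertices of its edges, $\chi(\mathsf{G})$ its set of colors; a subgraph is a subset. $\mathsf{G}$ is rainbow if $|\chi(\mathsf{G})|=|\mathsf{G}|$, almost rainbow if $|\chi(\mathsf{G})|=|\mathsf{G}|-1$. Paths, cycles, trees are graphs whose underlying edges form a path, cycle, tree; a cycle is long if its length is at least $6$. A theta graph is a union of three paths with common terminals $s,t$, pairwise sharing exactly the vertices $s,t$ and no edges. A bad piece is an almost rainbow theta graph, each of whose three paths is rainbow, with at least $6$ vertices. A partition of a graph $\mathsf{G}$ is a collection $\{\mathsf{G}_1,\dots,\mathsf{G}_m\}$ of graphs with union $\mathsf{G}$ such that $|V(\mathsf{G}_i)\cap V(\mathsf{G}_j)|\le 1$ and $\chi(\mathsf{G}_i)\cap\chi(\mathsf{G}_j)=\varnothing$ for $i\ne j$. A Frankenstein graph is a graph $\mathfrak{F}$ admitting a partition $\{\mathsf{C}_1,\dots,\mathsf{C}_c,\mathsf{B}_1,\dots,\mathsf{B}_b,\mathsf{T}_1,\dots,\mathsf{T}_t\}$ ($c,b,t\ge0$,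 $c+b+t\ge1$), where the $\mathsf{C}$'s are long rainbow cycles of odd length, the $\mathsf{B}$'s are bad pieces and the $\mathsf{T}$'s are rainbow trees, such that (F1) the trees $\mathsf{T}_p$ are pairwise vertex-disjoint, and (F2) no subgraph of $\mathfrak{F}$ is a rainbow cycle of even length. -}

module Defs where

open import Data.Nat using (ℕ; zero; suc; _+_; _≤_; _≟_)
open import Data.Nat using (_*_)
open import Data.Product using (Σ; ∃; ∃-syntax; _×_; _,_)
open import Data.Sum using (_⊎_)
open import Data.List using (List; []; _∷_; _++_; [_]; length; map; deduplicate; head; last; concat)
open import Data.List.Relation.Unary.All using (All)
open import Data.List.Relation.Unary.Any using (Any)
open import Data.List.Relation.Unary.AllPairs using (AllPairs)
open import Data.List.Relation.Unary.Unique.Propositional using (Unique)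
open import Data.List.Membership.Propositional using (_∈_)
open import Data.Maybe using (just)
open import Relation.Binary.PropositionalEquality using (_≡_; _≢_)
open import Relation.Nullary using (¬_)

-- Vertices and colours are natural numbers.
-- A coloured edge ({u,v}, α) is stored as a record; the orientation u,v is irrelevant.
record CEdge : Set where
  constructor ⟨_,_∣_⟩
  field
    u v col : ℕ
open CEdge public

SameEdge : CEdge → CEdge → Set
SameEdge e f = (u e ≡ u f × v e ≡ v f) ⊎ (u e ≡ v f × v e ≡ u f)

Joins : CEdge → ℕ × ℕ → Set
Joins e (a , b) = (u e ≡ a × v e ≡ b) ⊎ (u e ≡ b × v e ≡ a)

-- A (coloured) graph is a finite set of coloured edges, represented as a list;
-- well-formedness: endpoints distinct, and no two entries share the same
-- underlying edge (in particular no repeated entries, so the list is a set).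
Graph : Set
Graph = List CEdge

IsGraph : Graph → Set
IsGraph G = All (λ e → u e ≢ v e) G × AllPairs (λ e f → ¬ SameEdge e f) G

∣_∣ : Graph → ℕ
∣ G ∣ = length G

_∈V_ : ℕ → Graph → Set
x ∈V G = Any (λ e → x ≡ u e ⊎ x ≡ v e) G

χ : Graph → List ℕ
χ G = deduplicate _≟_ (map col G)

_⊆G_ : Graph → Graph → Set
H ⊆G G = IsGraph H × All (λ e → e ∈ G) H

_≈G_ : Graph → Graph → Set
G ≈G H = All (λ e → e ∈ H) G × All (λ e → e ∈ G) H

Rainbow : Graph → Set
Rainbow G = length (χ G) ≡ ∣ G ∣

AlmostRainbow : Graph → Set
AlmostRainbow G = suc (length (χ G)) ≡ ∣ G ∣

pairs : List ℕ → List (ℕ × ℕ)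
pairs [] = []
pairs (x ∷ []) = []
pairs (x ∷ y ∷ xs) = (x , y) ∷ pairs (y ∷ xs)

EdgesAre : Graph → List (ℕ × ℕ) → Set
EdgesAre G ps = All (λ e → Any (Joins e) ps) G × All (λ p → Any (λ e → Joins e p) G) ps

IsPath : Graph → ℕ → ℕ → Set
IsPath G s t = IsGraph G × Σ (List ℕ) λ vs →
  Unique vs × 2 ≤ length vs × head vs ≡ just s × last vs ≡ just t × EdgesAre G (pairs vs)

IsCycle : Graph → Set
IsCycle G = IsGraph G × Σ ℕ λ x → Σ (List ℕ) λ vs →
  Unique (x ∷ vs) × 3 ≤ length (x ∷ vs) × EdgesAre G (pairs (x ∷ vs ++ [ x ]))

LongCycle : Graph → Set
LongCycle G = IsCycle G × 6 ≤ ∣ G ∣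

Connected : Graph → Set
Connected G = ∀ x y → x ∈V G → y ∈V G → x ≢ y → Σ Graph λ P → P ⊆G G × IsPath P x y

Acyclic : Graph → Set
Acyclic G = ∀ H → H ⊆G G → ¬ IsCycle H

IsTree : Graph → Set
IsTree G = IsGraph G × Connected G × Acyclic G

IsThetaWith : Graph → ℕ → ℕ → Graph → Graph → Graph → Set
IsThetaWith G s t P₁ P₂ P₃ =
  IsGraph G × G ≈G (P₁ ++ P₂ ++ P₃) ×
  IsPath P₁ s t × IsPath P₂ s t × IsPath P₃ s t ×
  MeetOnlyAt P₁ P₂ × MeetOnlyAt P₁ P₃ × MeetOnlyAt P₂ P₃
  where
  MeetOnlyAt : Graph → Graph → Set
  MeetOnlyAt A B =
    (∀ x → x ∈V A → x ∈V B → x ≡ s ⊎ x ≡ t) ×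
    All (λ e → All (λ f → ¬ SameEdge e f) B) A

Even Odd : ℕ → Set
Even n = Σ ℕ λ k → n ≡ 2 * k
Odd n = Σ ℕ λ k → n ≡ suc (2 * k)

IsBadPiece : Graph → Set
IsBadPiece G = Σ ℕ λ s → Σ ℕ λ t → Σ Graph λ P₁ → Σ Graph λ P₂ → Σ Graph λ P₃ →
  IsThetaWith G s t P₁ P₂ P₃ × Rainbow P₁ × Rainbow P₂ × Rainbow P₃ ×
  AlmostRainbow G ×
  Σ (List ℕ) λ xs → Unique xs × 6 ≤ length xs × All (λ x → x ∈V G) xs

IsPartition : Graph → List Graph → Set
IsPartition G Gs =
  G ≈G concat Gs ×
  AllPairs (λ A B → (∀ x y → x ∈V A → x ∈V B → y ∈V A → y ∈V B → x ≡ y) ×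
                    (∀ α → α ∈ χ A → ¬ α ∈ χ B)) Gs

IsFrankenstein : Graph → Set
IsFrankenstein F = IsGraph F ×
  Σ (List Graph) λ Cs → Σ (List Graph) λ Bs → Σ (List Graph) λ Ts →
    All (λ C → LongCycle C × Rainbow C × Odd ∣ C ∣) Cs ×
    All IsBadPiece Bs ×
    All (λ T → IsTree T × Rainbow T) Ts ×
    1 ≤ length Cs + length Bs + length Ts ×
    IsPartition F (Cs ++ Bs ++ Ts) ×
    -- (F1)
    AllPairs (λ T T′ → ∀ x → x ∈V T → ¬ x ∈V T′) Ts ×
    -- (F2)
    (∀ H → H ⊆G F → IsCycle H → Rainbow H → ¬ Even ∣ H ∣)

-- A path is rerouted inside every bad piece B it meets: between its first and its last vertex
-- in B it is replaced by a walk inside B that uses no colour twice. Such a walk exists since the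
-- three paths of the theta graph are rainbow: two vertices on one path are joined along it, and
-- two vertices on different paths are joined by the two edge-disjoint arcs of the cycle formed by
-- those paths. If both arcs repeated a colour, deleting one edge of each repetition would keep
-- all colours of B while removing two edges, impossible for an almost rainbow B. Rerouting in one
-- piece does not spoil another, because pieces have disjoint colour sets. After shortcutting the
-- resulting walk to a path, two edges of equal colour lie in a common piece, which is rainbow or
-- was rerouted, so they coincide.

module Submission where

open import Defs
open import Data.Nat using (ℕ; suc; _≤_; _<_; z≤n; s≤s; _≟_)
open import Data.Nat.Properties using (≤-trans; ≤-reflexive; ≤-antisym; <-irrefl; module ≤-Reasoning)
open import Data.Product using (Σ; _×_; _,_; proj₁; proj₂)
open import Data.Sum using (_⊎_; inj₁; inj₂; [_,_]′; swap)
open import Data.Empty using (⊥-elim)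
open import Data.List using (List; []; _∷_; _++_; length; map; last; concat)
open import Data.List.Properties using (length-map; length-deduplicate; length-removeAt′)
open import Data.List.Relation.Unary.All as All using (All; []; _∷_)
import Data.List.Relation.Unary.All.Properties as All
open import Data.List.Relation.Unary.Any as Any using (Any; here; there; _─_; any?)
import Data.List.Relation.Unary.Any.Properties as Any
open import Data.List.Relation.Unary.AllPairs as AllPairs using (AllPairs; []; _∷_)
open import Data.List.Relation.Unary.Unique.Propositional using (Unique)
open import Data.List.Relation.Unary.Unique.DecPropositional.Properties _≟_ using (deduplicate-!)
open import Data.List.Relation.Binary.Subset.Propositional using (_⊆_)
open import Data.List.Relation.Binary.Subset.Propositional.Properties
  using (⊆-refl; ⊆-reflexive; ⊆-trans; xs⊆xs++ys; xs⊆ys++xs; ++⁺; Any-resp-⊆)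
open import Data.List.Relation.Binary.Disjoint.Propositional using (Disjoint)
import Data.List.Relation.Binary.Disjoint.Propositional.Properties as Disjoint
open import Data.List.Membership.Propositional using (_∈_; find; lose)
open import Data.List.Membership.Propositional.Properties
  using (∈-++⁺ˡ; ∈-++⁺ʳ; ∈-++⁻; ∈-map⁺; ∈-map⁻; ∈-deduplicate⁺; ∈-deduplicate⁻; ∈-concat⁻′; ∈-AllPairs₂)
open import Data.List.Membership.DecPropositional _≟_ using (_∈?_)
open import Data.Maybe using (just)
open import Data.Maybe.Properties using (just-injective)
open import Relation.Binary.Definitions using (DecidableEquality)
open import Relation.Binary.PropositionalEquality using (_≡_; _≢_; refl; sym; trans; cong; subst)
open import Relation.Nullary using (¬_; Dec; yes; no; ¬?; _×-dec_; _⊎-dec_)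
open import Relation.Nullary.Decidable using (map′; decidable-stable)

private
  variable
    A : Set
    a b s t x y z : ℕ
    e f : CEdge
    B X : Graph
    xs ys : List A

∈-─⁺ : {x y : A} (x∈xs : x ∈ xs) → y ∈ xs → y ≢ x → y ∈ (xs ─ x∈xs)
∈-─⁺ (here refl)  (here refl)  y≢x = ⊥-elim (y≢x refl)
∈-─⁺ (here refl)  (there y∈xs) _   = y∈xs
∈-─⁺ (there _)    (here refl)  _   = here refl
∈-─⁺ (there x∈xs) (there y∈xs) y≢x = there (∈-─⁺ x∈xs y∈xs y≢x)

unique-⊆⇒length-≤ : Unique xs → xs ⊆ ys → length xs ≤ length ys
unique-⊆⇒length-≤ [] _ = z≤n
unique-⊆⇒length-≤ {xs = x ∷ xs} {ys = ys} (x∉xs ∷ !xs) xs⊆ys = begin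
  suc (length xs)          ≤⟨ s≤s (unique-⊆⇒length-≤ !xs xs⊆ys─x) ⟩
  suc (length (ys ─ x∈ys)) ≡⟨ sym (length-removeAt′ ys _) ⟩
  length ys                ∎
  where
  open ≤-Reasoning
  x∈ys : x ∈ ys
  x∈ys = xs⊆ys (here refl)
  xs⊆ys─x : xs ⊆ (ys ─ x∈ys)
  xs⊆ys─x y∈xs = ∈-─⁺ x∈ys (xs⊆ys (there y∈xs)) (λ y≡x → All.lookup x∉xs y∈xs (sym y≡x))

unique-++⇒disjoint : (xs : List A) → Unique (xs ++ ys) → Disjoint xs ys
unique-++⇒disjoint []       _            (() , _)
unique-++⇒disjoint (x ∷ xs) (x∉ ∷ _)     (here refl , y∈ys)   = All.lookup x∉ (∈-++⁺ʳ xs y∈ys) refl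
unique-++⇒disjoint (x ∷ xs) (_ ∷ !xs++ys) (there y∈xs , y∈ys) = unique-++⇒disjoint xs !xs++ys (y∈xs , y∈ys)

-- Colours

_≟ᴱ_ : DecidableEquality CEdge
⟨ a , b ∣ c ⟩ ≟ᴱ ⟨ a′ , b′ ∣ c′ ⟩ =
  map′ (λ { (refl , refl , refl) → refl }) (λ { refl → refl , refl , refl }) (a ≟ a′ ×-dec b ≟ b′ ×-dec c ≟ c′)

ColourInjective : Graph → Set
ColourInjective X = ∀ {e f} → e ∈ X → f ∈ X → col e ≡ col f → e ≡ f

ColourInjectiveOn : Graph → Graph → Set
ColourInjectiveOn B X = ∀ {e f} → e ∈ X → f ∈ X → e ∈ B → f ∈ B → col e ≡ col f → e ≡ f

data Clash (X : Graph) : Set where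
  clash : e ∈ X → f ∈ X → e ≢ f → col e ≡ col f → Clash X

clash-⊆ : {Y : Graph} → X ⊆ Y → Clash X → Clash Y
clash-⊆ X⊆Y (clash e∈X f∈X e≢f same) = clash (X⊆Y e∈X) (X⊆Y f∈X) e≢f same

colourInjective-⊆ : {Y : Graph} → X ⊆ Y → ColourInjective Y → ColourInjective X
colourInjective-⊆ X⊆Y ci e∈X f∈X = ci (X⊆Y e∈X) (X⊆Y f∈X)

colourInjectiveOn-⊆ : {X′ : Graph} → X′ ⊆ X → ColourInjectiveOn B X → ColourInjectiveOn B X′
colourInjectiveOn-⊆ X′⊆X ci e∈ f∈ = ci (X′⊆X e∈) (X′⊆X f∈)

disjoint⇒colourInjectiveOn : Disjoint X B → ColourInjectiveOn B X
disjoint⇒colourInjectiveOn X#B e∈X _ e∈B _ _ = ⊥-elim (X#B (e∈X , e∈B))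

col∈χ : e ∈ X → col e ∈ χ X
col∈χ e∈X = ∈-deduplicate⁺ _≟_ (∈-map⁺ col e∈X)

χ-≤ : (X : Graph) → length (χ X) ≤ length X
χ-≤ X = ≤-trans (length-deduplicate _≟_ (map col X)) (≤-reflexive (length-map col X))

χ-mono : {Y : Graph} → map col X ⊆ map col Y → length (χ X) ≤ length (χ Y)
χ-mono {X} cols⊆ = unique-⊆⇒length-≤ (deduplicate-! (map col X))
  (λ α∈ → ∈-deduplicate⁺ _≟_ (cols⊆ (∈-deduplicate⁻ _≟_ (map col X) α∈)))

map-col-⊆-─ : e ∈ X → (f∈X : f ∈ X) → e ≢ f → col e ≡ col f → map col X ⊆ map col (X ─ f∈X)
map-col-⊆-─ {X = X} {f = f} e∈X f∈X e≢f same α∈ with ∈-map⁻ col α∈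
... | g , g∈X , refl with g ≟ᴱ f
...   | yes refl = subst (_∈ map col (X ─ f∈X)) same (∈-map⁺ col (∈-─⁺ f∈X e∈X e≢f))
...   | no g≢f = ∈-map⁺ col (∈-─⁺ f∈X g∈X g≢f)

clash⇒χ< : Clash X → length (χ X) < length X
clash⇒χ< {X} (clash e∈X f∈X e≢f same) = begin-strict
  length (χ X)         ≤⟨ χ-mono (map-col-⊆-─ e∈X f∈X e≢f same) ⟩
  length (χ (X ─ f∈X)) ≤⟨ χ-≤ (X ─ f∈X) ⟩
  length (X ─ f∈X)     <⟨ ≤-reflexive (sym (length-removeAt′ X _)) ⟩
  length X             ∎
  where open ≤-Reasoning

disjointClashes⇒χ< : {C D : Graph} → C ⊆ X → D ⊆ X → Disjoint C D → Clash C → Clash D →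
  suc (length (χ X)) < length X
disjointClashes⇒χ< {X} {D = D} C⊆X D⊆X C#D (clash {f = f} e∈C f∈C e≢f same) clash-D = begin-strict
  suc (length (χ X))         ≤⟨ s≤s (χ-mono (map-col-⊆-─ (C⊆X e∈C) f∈X e≢f same)) ⟩
  suc (length (χ (X ─ f∈X))) <⟨ s≤s (clash⇒χ< (clash-⊆ D⊆X─f clash-D)) ⟩
  suc (length (X ─ f∈X))     ≡⟨ sym (length-removeAt′ X _) ⟩
  length X                   ∎
  where
  open ≤-Reasoning
  f∈X : f ∈ X
  f∈X = C⊆X f∈C
  D⊆X─f : D ⊆ (X ─ f∈X)
  D⊆X─f g∈D = ∈-─⁺ f∈X (D⊆X g∈D) (λ { refl → C#D (f∈C , g∈D) })

rainbow⇒colourInjective : Rainbow X → ColourInjective X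
rainbow⇒colourInjective rainbow {e} {f} e∈X f∈X same with e ≟ᴱ f
... | yes e≡f = e≡f
... | no  e≢f = ⊥-elim (<-irrefl rainbow (clash⇒χ< (clash e∈X f∈X e≢f same)))

colourInjective⊎clash : (X : Graph) → ColourInjective X ⊎ Clash X
colourInjective⊎clash X with any? (λ e → any? (λ f → ¬? (e ≟ᴱ f) ×-dec col e ≟ col f) X) X
... | yes found with find found
...   | e , e∈X , found-f with find found-f
...     | f , f∈X , e≢f , same = inj₂ (clash e∈X f∈X e≢f same)
colourInjective⊎clash X | no none = inj₁ λ {e} {f} e∈X f∈X same →
  decidable-stable (e ≟ᴱ f) (λ e≢f → none (lose e∈X (lose f∈X (e≢f , same))))

almostRainbow⇒colourInjective⊎ : {C D : Graph} → AlmostRainbow X → C ⊆ X → D ⊆ X → Disjoint C D →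
  ColourInjective C ⊎ ColourInjective D
almostRainbow⇒colourInjective⊎ {C = C} {D} almost C⊆X D⊆X C#D
  with colourInjective⊎clash C | colourInjective⊎clash D
... | inj₁ ci-C    | _           = inj₁ ci-C
... | inj₂ _       | inj₁ ci-D   = inj₂ ci-D
... | inj₂ clash-C | inj₂ clash-D = ⊥-elim (<-irrefl almost (disjointClashes⇒χ< C⊆X D⊆X C#D clash-C clash-D))

colourInjective⇒uniqueColours : Unique X → ColourInjective X → Unique (map col X)
colourInjective⇒uniqueColours [] _ = []
colourInjective⇒uniqueColours (e∉X ∷ !X) ci =
  All.map⁺ (All.tabulate (λ f∈X same → All.lookup e∉X f∈X (ci (here refl) (there f∈X) same)))
  ∷ colourInjective⇒uniqueColours !X (λ e∈X f∈X → ci (there e∈X) (there f∈X))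

colourInjective⇒rainbow : Unique X → ColourInjective X → Rainbow X
colourInjective⇒rainbow {X} !X ci = ≤-antisym (χ-≤ X) (begin
  length X           ≡⟨ sym (length-map col X) ⟩
  length (map col X) ≤⟨ unique-⊆⇒length-≤ (colourInjective⇒uniqueColours !X ci) (∈-deduplicate⁺ _≟_) ⟩
  length (χ X)       ∎)
  where open ≤-Reasoning

-- Walks

data Walk : ℕ → ℕ → Set where
  nil  : Walk x x
  cons : (e : CEdge) → Joins e (x , y) → Walk y z → Walk x z

-- Keeping the first vertex outside the recursion makes [pairs (vertices w)] compute on [cons].
laterVertices : Walk x y → List ℕ
laterVertices nil = []
laterVertices (cons {y = y} _ _ w) = y ∷ laterVertices w

vertices : Walk x y → List ℕ
vertices {x} w = x ∷ laterVertices w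

edges : Walk x y → List CEdge
edges nil = []
edges (cons e _ w) = e ∷ edges w

_++ʷ_ : Walk x y → Walk y z → Walk x z
nil ++ʷ w′ = w′
cons e j w ++ʷ w′ = cons e j (w ++ʷ w′)

reverseʷ : Walk x y → Walk y x
reverseʷ nil = nil
reverseʷ (cons e j w) = reverseʷ w ++ʷ cons e (swap j) nil

edges-++ʷ : (w : Walk x y) (w′ : Walk y z) → edges (w ++ʷ w′) ≡ edges w ++ edges w′
edges-++ʷ nil w′ = refl
edges-++ʷ (cons e _ w) w′ = cong (e ∷_) (edges-++ʷ w w′)

∈-++ʷ⁻ : (w : Walk x y) (w′ : Walk y z) → e ∈ edges (w ++ʷ w′) → e ∈ edges w ⊎ e ∈ edges w′
∈-++ʷ⁻ w w′ e∈ = ∈-++⁻ (edges w) (⊆-reflexive (edges-++ʷ w w′) e∈)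

edges-reverseʷ-⊆ : (w : Walk x y) → edges (reverseʷ w) ⊆ edges w
edges-reverseʷ-⊆ (cons e j w) e′∈ with ∈-++ʷ⁻ (reverseʷ w) _ e′∈
... | inj₁ e′∈rw = there (edges-reverseʷ-⊆ w e′∈rw)
... | inj₂ (here refl) = here refl

edges-reverseʷ-⊇ : (w : Walk x y) → edges w ⊆ edges (reverseʷ w)
edges-reverseʷ-⊇ (cons e j w) (here refl) =
  ⊆-reflexive (sym (edges-++ʷ (reverseʷ w) _)) (∈-++⁺ʳ (edges (reverseʷ w)) (here refl))
edges-reverseʷ-⊇ (cons e j w) (there e′∈w) =
  ⊆-reflexive (sym (edges-++ʷ (reverseʷ w) _)) (∈-++⁺ˡ (edges-reverseʷ-⊇ w e′∈w))

splitAt : (w : Walk s t) → x ∈ vertices w →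
  Σ (Walk s x) λ w₁ → Σ (Walk x t) λ w₂ → edges w ≡ edges w₁ ++ edges w₂
splitAt nil (here refl) = nil , nil , refl
splitAt (cons e j w) (here refl) = nil , cons e j w , refl
splitAt (cons e j w) (there x∈w) with splitAt w x∈w
... | w₁ , w₂ , w≡ = cons e j w₁ , w₂ , cong (e ∷_) w≡

subwalk : (w : Walk s t) → x ∈ vertices w → y ∈ vertices w →
  Σ (Walk x y) λ w′ → edges w′ ⊆ edges w
subwalk w x∈w y∈w with splitAt w x∈w | splitAt w y∈w
... | w₁ , _ , w≡w₁++ | w₂ , _ , w≡w₂++ = reverseʷ w₁ ++ʷ w₂ , λ e∈ → inW (∈-++ʷ⁻ (reverseʷ w₁) w₂ e∈)
  where
  inW : ∀ {e} → e ∈ edges (reverseʷ w₁) ⊎ e ∈ edges w₂ → e ∈ edges w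
  inW (inj₁ e∈w̄₁) = ⊆-reflexive (sym w≡w₁++) (∈-++⁺ˡ (edges-reverseʷ-⊆ w₁ e∈w̄₁))
  inW (inj₂ e∈w₂) = ⊆-reflexive (sym w≡w₂++) (∈-++⁺ˡ e∈w₂)

suffixFrom : (w : Walk y z) → Unique (vertices w) → x ∈ vertices w →
  Σ (Walk x z) λ w′ → Unique (vertices w′) × edges w′ ⊆ edges w
suffixFrom nil !w (here refl) = nil , !w , ⊆-refl
suffixFrom (cons e j w) !w (here refl) = cons e j w , !w , ⊆-refl
suffixFrom (cons e j w) (_ ∷ !w) (there x∈w) with suffixFrom w !w x∈w
... | w′ , !w′ , w′⊆w = w′ , !w′ , λ e∈ → there (w′⊆w e∈)

shortcut : (w : Walk x y) → Σ (Walk x y) λ w′ → Unique (vertices w′) × edges w′ ⊆ edges w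
shortcut nil = nil , [] ∷ [] , λ ()
shortcut {x} (cons e j w) with shortcut w
... | w′ , !w′ , w′⊆w with x ∈? vertices w′
...   | yes x∈w′ =
  let w″ , !w″ , w″⊆w′ = suffixFrom w′ !w′ x∈w′ in w″ , !w″ , λ e∈ → there (w′⊆w (w″⊆w′ e∈))
...   | no  x∉w′ =
  cons e j w′ , All.¬Any⇒All¬ _ x∉w′ ∷ !w′ , λ { (here refl) → here refl ; (there e∈) → there (w′⊆w e∈) }

last∈vertices : (w : Walk x y) → y ∈ vertices w
last∈vertices nil = here refl
last∈vertices (cons _ _ w) = there (last∈vertices w)

Incident : ℕ → CEdge → Set
Incident z e = z ≡ u e ⊎ z ≡ v e

joins⇒incident : Joins e (a , b) → Incident a e
joins⇒incident (inj₁ (refl , _)) = inj₁ refl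
joins⇒incident (inj₂ (_ , refl)) = inj₂ refl

incident-joins : Joins e (a , b) → Incident z e → z ≡ a ⊎ z ≡ b
incident-joins (inj₁ (refl , refl)) z-e = z-e
incident-joins (inj₂ (refl , refl)) z-e = swap z-e

incident-sameEdge : {f : CEdge} → SameEdge e f → Incident z e → Incident z f
incident-sameEdge (inj₁ (refl , refl)) z-e = z-e
incident-sameEdge (inj₂ (refl , refl)) z-e = swap z-e

incident⇒∈vertices : (w : Walk x y) → e ∈ edges w → Incident z e → z ∈ vertices w
incident⇒∈vertices (cons e j w) (here refl) z-e with incident-joins {e = e} j z-e
... | inj₁ refl = here refl
... | inj₂ refl = there (here refl)
incident⇒∈vertices (cons _ _ w) (there e∈w) z-e = there (incident⇒∈vertices w e∈w z-e)

joins-loopless : a ≢ b → Joins e (a , b) → u e ≢ v e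
joins-loopless a≢b (inj₁ (refl , refl)) = a≢b
joins-loopless a≢b (inj₂ (refl , refl)) = λ b≡a → a≢b (sym b≡a)

isGraph⇒unique : IsGraph X → Unique X
isGraph⇒unique (_ , distinct) = AllPairs.map (λ ¬same e≡f → ¬same (inj₁ (cong u e≡f , cong v e≡f))) distinct

simpleWalk-isGraph : (w : Walk x y) → Unique (vertices w) → IsGraph (edges w)
simpleWalk-isGraph nil _ = [] , []
simpleWalk-isGraph (cons e j w) (x∉w ∷ !w) =
  let loopless , distinct = simpleWalk-isGraph w !w
  in  (joins-loopless {e = e} (All.lookup x∉w (here refl)) j ∷ loopless) ,
      (All.tabulate ¬sameEdge ∷ distinct)
  where
  ¬sameEdge : ∀ {f} → f ∈ edges w → ¬ SameEdge e f
  ¬sameEdge {f} f∈w same =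
    All.lookup x∉w (incident⇒∈vertices w f∈w
      (incident-sameEdge {e = e} {f = f} same (joins⇒incident {e = e} j))) refl

edgesArePairs : (w : Walk x y) → EdgesAre (edges w) (pairs (vertices w))
edgesArePairs nil = [] , []
edgesArePairs (cons e j w) =
  let covered , realised = edgesArePairs w
  in  (here j ∷ All.map there covered) , (here j ∷ All.map there realised)

last-vertices : (w : Walk x y) → last (vertices w) ≡ just y
last-vertices nil = refl
last-vertices (cons _ _ w) = last-vertices w

simpleWalk⇒isPath : (w : Walk s t) → Unique (vertices w) → s ≢ t → IsPath (edges w) s t
simpleWalk⇒isPath w !w s≢t =
  simpleWalk-isGraph w !w , vertices w , !w , two-vertices w s≢t , refl , last-vertices w , edgesArePairs w
  where
  two-vertices : (w : Walk s t) → s ≢ t → 2 ≤ length (vertices w)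
  two-vertices nil s≢s = ⊥-elim (s≢s refl)
  two-vertices (cons _ _ _) _ = s≤s (s≤s z≤n)

pairs⇒∈ : (xs : List ℕ) → (a , b) ∈ pairs xs → a ∈ xs × b ∈ xs
pairs⇒∈ (x ∷ y ∷ xs) (here refl) = here refl , there (here refl)
pairs⇒∈ (x ∷ y ∷ xs) (there ab∈) = let a∈ , b∈ = pairs⇒∈ (y ∷ xs) ab∈ in there a∈ , there b∈

walkAlong : (P : Graph) (rest : List ℕ) → All (λ p → Any (λ e → Joins e p) P) (pairs (x ∷ rest)) →
  Σ ℕ λ z → Σ (Walk x z) λ w → laterVertices w ≡ rest × edges w ⊆ P
walkAlong P [] _ = _ , nil , refl , λ ()
walkAlong P (y ∷ rest) (xy∈P ∷ realised) with find xy∈P | walkAlong P rest realised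
... | e , e∈P , j | z , w , w≡ , w⊆P =
  z , cons e j w , cong (y ∷_) w≡ , λ { (here refl) → e∈P ; (there e′∈w) → w⊆P e′∈w }

simpleWalk-ends≢ : (w : Walk x y) → Unique (vertices w) → 2 ≤ length (vertices w) → x ≢ y
simpleWalk-ends≢ nil _ (s≤s ())
simpleWalk-ends≢ (cons _ _ w) (x∉w ∷ _) _ = All.lookup x∉w (last∈vertices w)

isPath⇒simpleWalk : {P : Graph} → IsPath P s t →
  Σ (Walk s t) λ w → Unique (vertices w) × edges w ⊆ P × (∀ {z} → z ∈V P → z ∈ vertices w) × s ≢ t
isPath⇒simpleWalk {P = P} (_ , (s ∷ rest) , !vs , two , refl , last≡t , covered , realised)
  with walkAlong P rest realised
... | z , w , refl , w⊆P with just-injective (trans (sym (last-vertices w)) last≡t)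
... | refl = w , !vs , w⊆P , onWalk , simpleWalk-ends≢ w !vs two
  where
  onWalk : ∀ {z} → z ∈V P → z ∈ vertices w
  onWalk z∈P with find z∈P
  ... | e , e∈P , z-e with find (All.lookup covered e∈P)
  ...   | (a , b) , ab∈ , j with pairs⇒∈ (vertices w) ab∈ | incident-joins {e = e} j z-e
  ...     | a∈ , _ | inj₁ refl = a∈
  ...     | _ , b∈ | inj₂ refl = b∈

-- Colour-injective walks inside a bad piece

arcs : (w w′ : Walk s t) → Unique (edges w) → Unique (edges w′) → Disjoint (edges w) (edges w′) →
  x ∈ vertices w → y ∈ vertices w′ →
  Σ (Walk x y) λ r₁ → Σ (Walk x y) λ r₂ →
    edges r₁ ⊆ edges w ++ edges w′ × edges r₂ ⊆ edges w ++ edges w′ × Disjoint (edges r₁) (edges r₂)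
arcs w w′ !w !w′ w#w′ x∈w y∈w′ with splitAt w x∈w | splitAt w′ y∈w′
... | w₁ , w₂ , w≡ | w′₁ , w′₂ , w′≡ =
  reverseʷ w₁ ++ʷ w′₁ , w₂ ++ʷ reverseʷ w′₂ ,
  ⊆-trans r₁⊆ (++⁺ w₁⊆w w′₁⊆w′) , ⊆-trans r₂⊆ (++⁺ w₂⊆w w′₂⊆w′) , r₁#r₂
  where
  w₁⊆w : edges w₁ ⊆ edges w
  w₁⊆w = ⊆-trans (xs⊆xs++ys _ _) (⊆-reflexive (sym w≡))
  w₂⊆w : edges w₂ ⊆ edges w
  w₂⊆w = ⊆-trans (xs⊆ys++xs _ _) (⊆-reflexive (sym w≡))
  w′₁⊆w′ : edges w′₁ ⊆ edges w′
  w′₁⊆w′ = ⊆-trans (xs⊆xs++ys _ _) (⊆-reflexive (sym w′≡))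
  w′₂⊆w′ : edges w′₂ ⊆ edges w′
  w′₂⊆w′ = ⊆-trans (xs⊆ys++xs _ _) (⊆-reflexive (sym w′≡))
  r₁⊆ : edges (reverseʷ w₁ ++ʷ w′₁) ⊆ edges w₁ ++ edges w′₁
  r₁⊆ = ⊆-trans (⊆-reflexive (edges-++ʷ (reverseʷ w₁) w′₁)) (++⁺ (edges-reverseʷ-⊆ w₁) ⊆-refl)
  r₂⊆ : edges (w₂ ++ʷ reverseʷ w′₂) ⊆ edges w₂ ++ edges w′₂
  r₂⊆ = ⊆-trans (⊆-reflexive (edges-++ʷ w₂ (reverseʷ w′₂))) (++⁺ ⊆-refl (edges-reverseʷ-⊆ w′₂))
  r₁#r₂ : Disjoint (edges (reverseʷ w₁ ++ʷ w′₁)) (edges (w₂ ++ʷ reverseʷ w′₂))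
  r₁#r₂ (e∈r₁ , e∈r₂) with ∈-++⁻ (edges w₁) (r₁⊆ e∈r₁) | ∈-++⁻ (edges w₂) (r₂⊆ e∈r₂)
  ... | inj₁ e∈w₁  | inj₁ e∈w₂  = unique-++⇒disjoint (edges w₁) (subst Unique w≡ !w) (e∈w₁ , e∈w₂)
  ... | inj₁ e∈w₁  | inj₂ e∈w′₂ = w#w′ (w₁⊆w e∈w₁ , w′₂⊆w′ e∈w′₂)
  ... | inj₂ e∈w′₁ | inj₁ e∈w₂  = w#w′ (w₂⊆w e∈w₂ , w′₁⊆w′ e∈w′₁)
  ... | inj₂ e∈w′₁ | inj₂ e∈w′₂ = unique-++⇒disjoint (edges w′₁) (subst Unique w′≡ !w′) (e∈w′₁ , e∈w′₂)

colourInjectiveArc : AlmostRainbow B → (w w′ : Walk s t) → edges w ⊆ B → edges w′ ⊆ B →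
  Unique (edges w) → Unique (edges w′) → Disjoint (edges w) (edges w′) → x ∈ vertices w → y ∈ vertices w′ →
  Σ (Walk x y) λ r → edges r ⊆ B × ColourInjective (edges r)
colourInjectiveArc {B} almost w w′ w⊆B w′⊆B !w !w′ w#w′ x∈w y∈w′
  with arcs w w′ !w !w′ w#w′ x∈w y∈w′
... | r₁ , r₂ , r₁⊆ww′ , r₂⊆ww′ , r₁#r₂ =
  pick (almostRainbow⇒colourInjective⊎ almost r₁⊆B r₂⊆B r₁#r₂)
  where
  ww′⊆B : edges w ++ edges w′ ⊆ B
  ww′⊆B e∈ = [ w⊆B , w′⊆B ]′ (∈-++⁻ (edges w) e∈)
  r₁⊆B : edges r₁ ⊆ B
  r₁⊆B = ⊆-trans r₁⊆ww′ ww′⊆B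
  r₂⊆B : edges r₂ ⊆ B
  r₂⊆B = ⊆-trans r₂⊆ww′ ww′⊆B
  pick : ColourInjective (edges r₁) ⊎ ColourInjective (edges r₂) →
    Σ (Walk _ _) λ r → edges r ⊆ B × ColourInjective (edges r)
  pick (inj₁ ci₁) = r₁ , r₁⊆B , ci₁
  pick (inj₂ ci₂) = r₂ , r₂⊆B , ci₂

ColourInjectiveTrailIn : Graph → Walk x y → Set
ColourInjectiveTrailIn B w = edges w ⊆ B × Unique (edges w) × ColourInjective (edges w)

colourInjectiveWalk-inUnion : AlmostRainbow B → (ws : List (Walk s t)) → All (ColourInjectiveTrailIn B) ws →
  AllPairs (λ w w′ → Disjoint (edges w) (edges w′)) ws →
  Any (λ w → x ∈ vertices w) ws → Any (λ w → y ∈ vertices w) ws →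
  Σ (Walk x y) λ r → edges r ⊆ B × ColourInjective (edges r)
colourInjectiveWalk-inUnion almost ws props disjoint x∈ws y∈ws with find x∈ws | find y∈ws
... | w , w∈ws , x∈w | w′ , w′∈ws , y∈w′
  with All.lookup props w∈ws | All.lookup props w′∈ws | ∈-AllPairs₂ disjoint w∈ws w′∈ws
... | w⊆B , _ , ci | _ | inj₁ refl =
  let r , r⊆w = subwalk w x∈w y∈w′ in r , ⊆-trans r⊆w w⊆B , colourInjective-⊆ r⊆w ci
... | w⊆B , !w , _ | w′⊆B , !w′ , _ | inj₂ (inj₁ w#w′) =
  colourInjectiveArc almost w w′ w⊆B w′⊆B !w !w′ w#w′ x∈w y∈w′
... | w⊆B , !w , _ | w′⊆B , !w′ , _ | inj₂ (inj₂ w′#w) =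
  colourInjectiveArc almost w w′ w⊆B w′⊆B !w !w′ (Disjoint.sym w′#w) x∈w y∈w′

noSharedEdge⇒disjoint : {Y : Graph} → All (λ e → All (λ f → ¬ SameEdge e f) Y) X → Disjoint X Y
noSharedEdge⇒disjoint noShared (e∈X , e∈Y) = All.lookup (All.lookup noShared e∈X) e∈Y (inj₁ (refl , refl))

badPiece-colourInjectiveWalk : IsBadPiece B → x ∈V B → y ∈V B →
  Σ (Walk x y) λ r → edges r ⊆ B × ColourInjective (edges r)
badPiece-colourInjectiveWalk {B}
  (s , t , P₁ , P₂ , P₃ , (_ , (B⊆ , ⊆B) , path₁ , path₂ , path₃ , (_ , P₁#P₂) , (_ , P₁#P₃) , (_ , P₂#P₃)) ,
   rainbow₁ , rainbow₂ , rainbow₃ , almost , _) x∈B y∈B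
  with isPath⇒simpleWalk path₁ | isPath⇒simpleWalk path₂ | isPath⇒simpleWalk path₃
... | w₁ , !w₁ , w₁⊆P₁ , on₁ , _ | w₂ , !w₂ , w₂⊆P₂ , on₂ , _ | w₃ , !w₃ , w₃⊆P₃ , on₃ , _ =
  colourInjectiveWalk-inUnion almost (w₁ ∷ w₂ ∷ w₃ ∷ [])
    (trail w₁ !w₁ w₁⊆P₁ P₁⊆B rainbow₁ ∷ trail w₂ !w₂ w₂⊆P₂ P₂⊆B rainbow₂ ∷
     trail w₃ !w₃ w₃⊆P₃ P₃⊆B rainbow₃ ∷ [])
    ((disjointWalks w₁⊆P₁ w₂⊆P₂ P₁#P₂ ∷ disjointWalks w₁⊆P₁ w₃⊆P₃ P₁#P₃ ∷ []) ∷
     (disjointWalks w₂⊆P₂ w₃⊆P₃ P₂#P₃ ∷ []) ∷ [] ∷ [])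
    (onWalks x∈B) (onWalks y∈B)
  where
  P₁⊆B : P₁ ⊆ B
  P₁⊆B e∈ = All.lookup ⊆B (∈-++⁺ˡ e∈)
  P₂⊆B : P₂ ⊆ B
  P₂⊆B e∈ = All.lookup ⊆B (∈-++⁺ʳ P₁ (∈-++⁺ˡ e∈))
  P₃⊆B : P₃ ⊆ B
  P₃⊆B e∈ = All.lookup ⊆B (∈-++⁺ʳ P₁ (∈-++⁺ʳ P₂ e∈))
  trail : {P : Graph} (w : Walk s t) → Unique (vertices w) → edges w ⊆ P → P ⊆ B → Rainbow P →
    ColourInjectiveTrailIn B w
  trail w !w w⊆P P⊆B rainbow =
    ⊆-trans w⊆P P⊆B , isGraph⇒unique (simpleWalk-isGraph w !w) ,
    colourInjective-⊆ w⊆P (rainbow⇒colourInjective rainbow)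
  disjointWalks : {P Q : Graph} {w w′ : Walk s t} → edges w ⊆ P → edges w′ ⊆ Q →
    All (λ e → All (λ f → ¬ SameEdge e f) Q) P → Disjoint (edges w) (edges w′)
  disjointWalks w⊆P w′⊆Q P#Q (e∈w , e∈w′) = noSharedEdge⇒disjoint P#Q (w⊆P e∈w , w′⊆Q e∈w′)
  onWalks : ∀ {z} → z ∈V B → Any (λ w → z ∈ vertices w) (w₁ ∷ w₂ ∷ w₃ ∷ [])
  onWalks z∈B with Any.++⁻ P₁ (Any-resp-⊆ (All.lookup B⊆) z∈B)
  ... | inj₁ z∈P₁ = here (on₁ z∈P₁)
  ... | inj₂ z∈P₂₃ with Any.++⁻ P₂ z∈P₂₃
  ...   | inj₁ z∈P₂ = there (here (on₂ z∈P₂))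
  ...   | inj₂ z∈P₃ = there (there (here (on₃ z∈P₃)))

-- Rerouting

_∈V?_ : (z : ℕ) (X : Graph) → Dec (z ∈V X)
z ∈V? X = any? (λ e → z ≟ u e ⊎-dec z ≟ v e) X

∷-disjoint : {es : Graph} → ¬ (a ∈V B) → Joins e (a , b) → Disjoint es B → Disjoint (e ∷ es) B
∷-disjoint {e = e} a∉B j _ (here refl , e∈B) = a∉B (lose e∈B (joins⇒incident {e = e} j))
∷-disjoint a∉B j es#B (there e′∈es , e′∈B) = es#B (e′∈es , e′∈B)

firstVertexIn : (B : Graph) (w : Walk a b) →
  Disjoint (edges w) B ⊎
  Σ ℕ λ x → x ∈V B × Σ (Walk a x) λ w′ → Disjoint (edges w′) B × edges w′ ⊆ edges w
firstVertexIn {a = a} B w with a ∈V? B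
... | yes a∈B = inj₂ (a , a∈B , nil , (λ { (() , _) }) , λ ())
firstVertexIn B nil | no _ = inj₁ λ { (() , _) }
firstVertexIn B (cons e j w) | no a∉B with firstVertexIn B w
... | inj₁ w#B = inj₁ (∷-disjoint {e = e} a∉B j w#B)
... | inj₂ (z , z∈B , w′ , w′#B , w′⊆w) =
  inj₂ (z , z∈B , cons e j w′ , ∷-disjoint {e = e} a∉B j w′#B ,
        λ { (here refl) → here refl ; (there e′∈) → there (w′⊆w e′∈) })

reroute : IsBadPiece B → (w : Walk s t) →
  Σ (Walk s t) λ w′ → edges w′ ⊆ edges w ++ B × ColourInjectiveOn B (edges w′)
reroute {B} bad w with firstVertexIn B w | firstVertexIn B (reverseʷ w)
... | inj₁ w#B | _ = w , xs⊆xs++ys _ _ , disjoint⇒colourInjectiveOn w#B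
... | inj₂ _ | inj₁ rw#B =
  w , xs⊆xs++ys _ _ , disjoint⇒colourInjectiveOn (λ (e∈w , e∈B) → rw#B (edges-reverseʷ-⊇ w e∈w , e∈B))
-- x is the first and y the last vertex of w in B; rsuf runs backwards from t to y.
... | inj₂ (x , x∈B , pre , pre#B , pre⊆w) | inj₂ (y , y∈B , rsuf , rsuf#B , rsuf⊆rw)
  with badPiece-colourInjectiveWalk bad x∈B y∈B
... | r , r⊆B , ci = pre ++ʷ (r ++ʷ reverseʷ rsuf) , ⊆w++B , ci-on
  where
  parts : ∀ {e} → e ∈ edges (pre ++ʷ (r ++ʷ reverseʷ rsuf)) → e ∈ edges pre ⊎ e ∈ edges r ⊎ e ∈ edges rsuf
  parts e∈ with ∈-++ʷ⁻ pre _ e∈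
  ... | inj₁ e∈pre = inj₁ e∈pre
  ... | inj₂ e∈rest with ∈-++ʷ⁻ r _ e∈rest
  ...   | inj₁ e∈r = inj₂ (inj₁ e∈r)
  ...   | inj₂ e∈rsuf = inj₂ (inj₂ (edges-reverseʷ-⊆ rsuf e∈rsuf))
  ⊆w++B : edges (pre ++ʷ (r ++ʷ reverseʷ rsuf)) ⊆ edges w ++ B
  ⊆w++B e∈ with parts e∈
  ... | inj₁ e∈pre = ∈-++⁺ˡ (pre⊆w e∈pre)
  ... | inj₂ (inj₁ e∈r) = ∈-++⁺ʳ (edges w) (r⊆B e∈r)
  ... | inj₂ (inj₂ e∈rsuf) = ∈-++⁺ˡ (edges-reverseʷ-⊆ w (rsuf⊆rw e∈rsuf))
  inB⇒inR : ∀ {e} → e ∈ edges (pre ++ʷ (r ++ʷ reverseʷ rsuf)) → e ∈ B → e ∈ edges r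
  inB⇒inR e∈ e∈B with parts e∈
  ... | inj₁ e∈pre = ⊥-elim (pre#B (e∈pre , e∈B))
  ... | inj₂ (inj₁ e∈r) = e∈r
  ... | inj₂ (inj₂ e∈rsuf) = ⊥-elim (rsuf#B (e∈rsuf , e∈B))
  ci-on : ColourInjectiveOn B (edges (pre ++ʷ (r ++ʷ reverseʷ rsuf)))
  ci-on e∈ f∈ e∈B f∈B = ci (inB⇒inR e∈ e∈B) (inB⇒inR f∈ f∈B)

colourInjectiveOn-preserved : {G H es es′ : Graph} → Disjoint (χ G) (χ H) → es′ ⊆ es ++ G →
  ColourInjectiveOn H es → ColourInjectiveOn H es′
colourInjectiveOn-preserved {G} {H} {es} {es′} G#H es′⊆ ci e∈ f∈ e∈H f∈H =
  ci (back e∈ e∈H) (back f∈ f∈H) e∈H f∈H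
  where
  back : ∀ {e} → e ∈ es′ → e ∈ H → e ∈ es
  back e∈ e∈H with ∈-++⁻ es (es′⊆ e∈)
  ... | inj₁ e∈es = e∈es
  ... | inj₂ e∈G = ⊥-elim (G#H (col∈χ e∈G , col∈χ e∈H))

reroutePiece : {G : Graph} → IsBadPiece G ⊎ Rainbow G → (w : Walk s t) →
  Σ (Walk s t) λ w′ → edges w′ ⊆ edges w ++ G × ColourInjectiveOn G (edges w′)
reroutePiece (inj₁ bad) w = reroute bad w
reroutePiece (inj₂ rainbow) w = w , xs⊆xs++ys _ _ , λ _ _ → rainbow⇒colourInjective rainbow

rerouteAll : (Gs : List Graph) → All (λ G → IsBadPiece G ⊎ Rainbow G) Gs →
  AllPairs (λ G H → Disjoint (χ G) (χ H)) Gs → (w : Walk s t) →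
  Σ (Walk s t) λ w′ → edges w′ ⊆ edges w ++ concat Gs × All (λ G → ColourInjectiveOn G (edges w′)) Gs
rerouteAll [] [] [] w = w , xs⊆xs++ys _ _ , []
rerouteAll (G ∷ Gs) (kind ∷ kinds) (G#Gs ∷ disjoint) w with rerouteAll Gs kinds disjoint w
... | w₁ , w₁⊆w++Gs , cis₁ with reroutePiece kind w₁
... | w₂ , w₂⊆w₁++G , ci₂ =
  w₂ , w₂⊆ , ci₂ ∷ All.zipWith preserved (G#Gs , cis₁)
  where
  preserved : ∀ {H} → Disjoint (χ G) (χ H) × ColourInjectiveOn H (edges w₁) → ColourInjectiveOn H (edges w₂)
  preserved (G#H , ci₁) = colourInjectiveOn-preserved G#H w₂⊆w₁++G ci₁
  w₂⊆ : edges w₂ ⊆ edges w ++ G ++ concat Gs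
  w₂⊆ e∈ with ∈-++⁻ (edges w₁) (w₂⊆w₁++G e∈)
  ... | inj₂ e∈G = ∈-++⁺ʳ (edges w) (∈-++⁺ˡ e∈G)
  ... | inj₁ e∈w₁ with ∈-++⁻ (edges w) (w₁⊆w++Gs e∈w₁)
  ...   | inj₁ e∈w = ∈-++⁺ˡ e∈w
  ...   | inj₂ e∈Gs = ∈-++⁺ʳ (edges w) (∈-++⁺ʳ G e∈Gs)

colourInjective-byParts : (Gs : List Graph) → AllPairs (λ G H → Disjoint (χ G) (χ H)) Gs →
  X ⊆ concat Gs → All (λ G → ColourInjectiveOn G X) Gs → ColourInjective X
colourInjective-byParts Gs disjoint X⊆ cis e∈X f∈X same
  with ∈-concat⁻′ Gs (X⊆ e∈X) | ∈-concat⁻′ Gs (X⊆ f∈X)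
... | G , e∈G , G∈Gs | H , f∈H , H∈Gs with ∈-AllPairs₂ disjoint G∈Gs H∈Gs
... | inj₁ refl       = All.lookup cis G∈Gs e∈X f∈X e∈G f∈H same
... | inj₂ (inj₁ G#H) = ⊥-elim (G#H (col∈χ e∈G , subst (_∈ χ H) (sym same) (col∈χ f∈H)))
... | inj₂ (inj₂ H#G) = ⊥-elim (H#G (col∈χ f∈H , subst (_∈ χ G) same (col∈χ e∈G)))

rainbowPath-inPartition : {F P : Graph} (Gs : List Graph) → F ⊆ concat Gs → concat Gs ⊆ F →
  All (λ G → IsBadPiece G ⊎ Rainbow G) Gs → AllPairs (λ G H → Disjoint (χ G) (χ H)) Gs →
  P ⊆ F → IsPath P s t → Σ Graph λ P′ → P′ ⊆G F × IsPath P′ s t × Rainbow P′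
rainbowPath-inPartition {F = F} Gs F⊆Gs Gs⊆F kinds disjoint P⊆F path with isPath⇒simpleWalk path
... | w , _ , w⊆P , _ , s≢t with rerouteAll Gs kinds disjoint w
... | w′ , w′⊆ , cis with shortcut w′
... | p , simple , p⊆w′ =
  edges p , (isGraph , All.tabulate p⊆F) , simpleWalk⇒isPath p simple s≢t ,
  colourInjective⇒rainbow (isGraph⇒unique isGraph)
    (colourInjective-byParts Gs disjoint (⊆-trans p⊆F F⊆Gs) (All.map (colourInjectiveOn-⊆ p⊆w′) cis))
  where
  isGraph : IsGraph (edges p)
  isGraph = simpleWalk-isGraph p simple
  p⊆F : edges p ⊆ F
  p⊆F e∈ with ∈-++⁻ (edges w) (w′⊆ (p⊆w′ e∈))
  ... | inj₁ e∈w = P⊆F (w⊆P e∈w)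
  ... | inj₂ e∈Gs = Gs⊆F e∈Gs

proposition2p9 : (F : Graph) → IsFrankenstein F →
    (P : Graph) (s t : ℕ) → P ⊆G F → IsPath P s t →
    Σ Graph λ P′ → P′ ⊆G F × IsPath P′ s t × Rainbow P′
proposition2p9 F (_ , Cs , Bs , Ts , cycles , bads , trees , _ , ((F⊆ , ⊆F) , partition) , _)
               P s t (_ , P⊆F) path =
  rainbowPath-inPartition (Cs ++ Bs ++ Ts) (All.lookup F⊆) (All.lookup ⊆F) kinds colourDisjoint
    (All.lookup P⊆F) path
  where
  kinds : All (λ G → IsBadPiece G ⊎ Rainbow G) (Cs ++ Bs ++ Ts)
  kinds = All.++⁺ (All.map (λ cycle → inj₂ (proj₁ (proj₂ cycle))) cycles)
                  (All.++⁺ (All.map inj₁ bads) (All.map (λ tree → inj₂ (proj₂ tree)) trees))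
  colourDisjoint : AllPairs (λ G H → Disjoint (χ G) (χ H)) (Cs ++ Bs ++ Ts)
  colourDisjoint = AllPairs.map (λ (_ , χ#) {α} (α∈G , α∈H) → χ# α α∈G α∈H) partition
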